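{- Let $s\geq 4$ be an even integer. For all integers $n,k\geq 1$, \[ C_{s}(n,k)=\sum_{\ell\in N(s)} C_{s}^{\ell}(n,k)+C_{s}^{s+1}(n,k), \] and moreover, for every $\ell\in N(s)$, \[ C_{s}^{\ell}(n,k)=C_{s}(n-\ell,k-1)-\sum_{i\in N'(\ell)}C_{s}^{i}(n-\ell,k-1) \quad\text{and}\quad C_{s}^{s+1}(n,k)=C_{s}(n-sk,k). \]
   Context: A partition is $s$-congruent if none of its parts is congruent to $2,4,\dots,s-2$ modulo $s$. $C_s(n,k)$ is the number of $s$-congruent partitions of $n$ into exactly $k$ parts. $N(s)=\{1,3,5,\dots,s-1\}\cup\{s\}$, and for $\ell\in N(s)$, $N'(\ell)$ is the set of odd positive integers less than $\ell$. For $\ell\in N(s)$, $C_s^{\ell}(n,k)$ is the number of $s$-congruent partitions of $n$ into $k$ parts whose smallest part equals $\ell$; $C_s^{s+1}(n,k)$ is the number of $s$-congruent partitions of $n$ into $k$ parts all of which are greater than $s$. Conventions: $C_s(0,0)=1$, $C_s(m,0)=0$ for $m\neq 0$, and all these counts are $0$ when the first argument is negative. -}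

module Defs where

open import Data.Bool using (Bool; true; false; _∧_; _∨_; not)
open import Data.Nat using (ℕ; zero; suc; _+_; _*_; _∸_; _%_; _≡ᵇ_; _≤ᵇ_; _<ᵇ_)
open import Data.Integer using (ℤ; +_; -[1+_])
open import Data.List using (List; []; _∷_; [_]; map; concatMap; filter; length; upTo; foldr)
open import Data.Vec using (Vec; []; _∷_)
open import Relation.Nullary.Decidable using (does)
open import Relation.Nullary using (Dec; yes; no)
open import Data.Bool using (T)
open import Data.Bool.Properties using (T?)

isEven : ℕ → Bool
isEven n = n % 2 ≡ᵇ 0

isOdd : ℕ → Bool
isOdd n = not (isEven n)

-- A partition of n into exactly k parts is represented as a weakly
-- decreasing vector of k positive integers whose sum is n.

vsum : ∀ {k} → Vec ℕ k → ℕ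
vsum []       = 0
vsum (x ∷ xs) = x + vsum xs

allV : ∀ {k} → (ℕ → Bool) → Vec ℕ k → Bool
allV p []       = true
allV p (x ∷ xs) = p x ∧ allV p xs

anyV : ∀ {k} → (ℕ → Bool) → Vec ℕ k → Bool
anyV p []       = false
anyV p (x ∷ xs) = p x ∨ anyV p xs

nonIncreasing : ∀ {k} → Vec ℕ k → Bool
nonIncreasing []            = true
nonIncreasing (x ∷ [])      = true
nonIncreasing (x ∷ y ∷ xs)  = (y ≤ᵇ x) ∧ nonIncreasing (y ∷ xs)

isPartition : ∀ {k} → ℕ → Vec ℕ k → Bool
isPartition n v = allV (λ x → 1 ≤ᵇ x) v ∧ nonIncreasing v ∧ (vsum v ≡ᵇ n)

-- all vectors of length k with entries in {1,…,n}; every partition of n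
-- into k parts occurs exactly once in this list
candidates : (k n : ℕ) → List (Vec ℕ k)
candidates zero    n = [ [] ]
candidates (suc k) n =
  concatMap (λ x → map (x ∷_) (candidates k n)) (map suc (upTo n))

forbiddenResidue : ℕ → ℕ → Bool
forbiddenResidue s x = let r = x % suc (s ∸ 1) in
  isEven r ∧ (2 ≤ᵇ r) ∧ (r ≤ᵇ s ∸ 2)

sCongruent : ∀ {k} → ℕ → Vec ℕ k → Bool
sCongruent s v = allV (λ x → not (forbiddenResidue s x)) v

countParts : (k : ℕ) → (Vec ℕ k → Bool) → ℤ → ℕ
countParts k P (+ n)    =
  length (filter (λ v → T? (isPartition n v ∧ P v)) (candidates k n))
countParts k P -[1+ _ ] = 0

C : (s : ℕ) → ℤ → ℕ → ℕ
C s n k = countParts k (sCongruent s) n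

Cℓ : (s ℓ : ℕ) → ℤ → ℕ → ℕ
Cℓ s ℓ n k = countParts k
  (λ v → sCongruent s v ∧ allV (λ x → ℓ ≤ᵇ x) v ∧ anyV (λ x → x ≡ᵇ ℓ) v) n

Cbig : (s : ℕ) → ℤ → ℕ → ℕ
Cbig s n k = countParts k (λ v → sCongruent s v ∧ allV (λ x → s <ᵇ x) v) n

N : ℕ → List ℕ
N s = filter (λ ℓ → T? ((isOdd ℓ ∧ (ℓ <ᵇ s)) ∨ (ℓ ≡ᵇ s))) (map suc (upTo s))

N′ : ℕ → List ℕ
N′ ℓ = filter (λ i → T? (isOdd i)) (map suc (upTo (ℓ ∸ 1)))

Σℤ : List ℕ → (ℕ → ℤ) → ℤ
Σℤ xs f = foldr (λ x acc → f x Data.Integer.+ acc) (+ 0) xs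

{-# OPTIONS --safe #-}
module Submission where

-- A partition into k ≥ 1 parts, stored as a non-increasing vector, ends with its smallest
-- part m.  If the partition is s-congruent then m is allowed, and for even s an allowed
-- m ≤ s is odd or equal to s; so m ∈ N(s) exactly when m ≤ s, which splits C_s(n,k).
-- Deleting the last part ℓ maps the partitions with smallest part ℓ bijectively onto the
-- partitions of n − ℓ into k − 1 parts that are all ≥ ℓ, and those are the partitions
-- counted by C_s(n−ℓ,k−1) whose smallest part is not an odd number below ℓ.  Subtracting s
-- from every part maps the partitions with all parts > s bijectively onto the partitions
-- of n − sk, and it does not change residues modulo s.  Since the enumeration used to count
-- partitions has no duplicates, a bijection between two filtered enumerations makes them
-- equal as bags, hence equally long.

open import Defs

module Lemmas where

  open import Algebra.Properties.CommutativeSemigroup using (interchange)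
  open import Data.Bool using (Bool; true; false; T; not; _∧_; _∨_)
  open import Data.Bool.Properties using (T?; T-∧; T-∨; T-≡; T-not-≡; ∧-assoc; ∧-identityʳ)
  open import Data.Empty using (⊥; ⊥-elim)
  open import Data.Integer as ℤ using (ℤ; +_; -[1+_]; _-_)
  open import Data.Integer.Properties using ([+m]-[+n]≡m⊖n; ⊖-≥; ⊖-<)
  open import Data.List using (List; []; _∷_; _++_; map; filter; length; upTo; concatMap; cartesianProductWith)
  open import Data.List.Membership.Propositional using (_∈_; _∉_)
  open import Data.List.Membership.Propositional.Properties
    using ( ∈-filter⁺; ∈-filter⁻; ∈-map⁺; ∈-map⁻; ∈-upTo⁺; ∈-upTo⁻
          ; ∈-map∘filter⁺; ∈-map∘filter⁻; ∈-cartesianProductWith⁺)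
  open import Data.List.Membership.Propositional.Properties.WithK using (unique∧set⇒bag)
  open import Data.List.Properties using (length-map; filter-none)
  open import Data.List.Relation.Binary.BagAndSetEquality using (_∼[_]_; set; ∼bag⇒↭)
  open import Data.List.Relation.Binary.Permutation.Propositional.Properties using (↭-length)
  open import Data.List.Relation.Unary.All as All using ([]; _∷_)
  open import Data.List.Relation.Unary.Any using (here; there)
  open import Data.List.Relation.Unary.Unique.Propositional using (Unique; []; _∷_)
  import Data.List.Relation.Unary.Unique.Propositional.Properties as Unique
  open import Data.Nat
    using (ℕ; zero; suc; _+_; _*_; _∸_; _≤_; _<_; z≤n; s≤s; s≤s⁻¹; _≡ᵇ_; _≤ᵇ_; _<ᵇ_; _%_; _≟_; _≤?_)
  open import Data.Nat.DivMod using ([m+n]%n≡m%n; m<n⇒m%n≡m; m*n%n≡0; n%n≡0)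
  open import Data.Nat.Divisibility using (_∣_; divides; m%n≡0⇒n∣m)
  open import Data.Nat.Properties
  open import Data.Product using (_×_; _,_; proj₁; proj₂; ∃-syntax)
  open import Data.Sum using (_⊎_; inj₁; inj₂)
  open import Data.Unit using (tt)
  open import Data.Vec as Vec using (Vec; []; _∷_; _∷ʳ_; initLast)
  open import Data.Vec.Properties using (∷-injective; ∷ʳ-injectiveˡ)
  open import Function using (_∘_; _⇔_; mk⇔; Equivalence)
  open import Function.Definitions using (Injective)
  open import Relation.Binary.PropositionalEquality
  open import Relation.Nullary using (¬_; yes; no)

  open Equivalence using (to; from)

  private
    variable
      A B D : Set
      k : ℕ

  𝟙 : Bool → ℕ
  𝟙 true  = 1
  𝟙 false = 0

  𝟙-cong : ∀ {a b} → T a ⇔ T b → 𝟙 a ≡ 𝟙 b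
  𝟙-cong {false} {false} _   = refl
  𝟙-cong {false} {true}  a⇔b = ⊥-elim (from a⇔b tt)
  𝟙-cong {true}  {false} a⇔b = ⊥-elim (to a⇔b tt)
  𝟙-cong {true}  {true}  _   = refl

  Σℕ : List A → (A → ℕ) → ℕ
  Σℕ []       f = 0
  Σℕ (x ∷ xs) f = f x + Σℕ xs f

  Σℕ-cong : (xs : List A) {f g : A → ℕ} → (∀ x → f x ≡ g x) → Σℕ xs f ≡ Σℕ xs g
  Σℕ-cong []       f≗g = refl
  Σℕ-cong (x ∷ xs) f≗g = cong₂ _+_ (f≗g x) (Σℕ-cong xs f≗g)

  Σℕ-zero : (xs : List A) → Σℕ xs (λ _ → 0) ≡ 0
  Σℕ-zero []       = refl
  Σℕ-zero (x ∷ xs) = Σℕ-zero xs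

  Σℕ-+ : (xs : List A) (f g : A → ℕ) → Σℕ xs (λ x → f x + g x) ≡ Σℕ xs f + Σℕ xs g
  Σℕ-+ []       f g = refl
  Σℕ-+ (x ∷ xs) f g = begin
    f x + g x + Σℕ xs (λ x → f x + g x)  ≡⟨ cong (_+_ (f x + g x)) (Σℕ-+ xs f g) ⟩
    f x + g x + (Σℕ xs f + Σℕ xs g)      ≡⟨ interchange +-commutativeSemigroup (f x) (g x) _ _ ⟩
    f x + Σℕ xs f + (g x + Σℕ xs g)      ∎
    where open ≡-Reasoning

  Σℕ-𝟙-≡ᵇ-∉ : (xs : List ℕ) {m : ℕ} → m ∉ xs → Σℕ xs (λ x → 𝟙 (x ≡ᵇ m)) ≡ 0
  Σℕ-𝟙-≡ᵇ-∉ []           m∉xs = refl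
  Σℕ-𝟙-≡ᵇ-∉ (x ∷ xs) {m} m∉xs = cong₂ _+_
    (𝟙-cong {b = false} (mk⇔ (λ x≡ᵇm → m∉xs (here (sym (≡ᵇ⇒≡ x m x≡ᵇm)))) λ ()))
    (Σℕ-𝟙-≡ᵇ-∉ xs (m∉xs ∘ there))

  Σℕ-𝟙-≡ᵇ-∈ : {xs : List ℕ} {m : ℕ} → Unique xs → m ∈ xs → Σℕ xs (λ x → 𝟙 (x ≡ᵇ m)) ≡ 1
  Σℕ-𝟙-≡ᵇ-∈ {x ∷ xs}     (x≢xs ∷ _)         (here refl) = cong₂ _+_
    (𝟙-cong {b = true} (mk⇔ _ (λ _ → ≡⇒≡ᵇ x x refl)))
    (Σℕ-𝟙-≡ᵇ-∉ xs (λ x∈xs → All.lookup x≢xs x∈xs refl))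
  Σℕ-𝟙-≡ᵇ-∈ {x ∷ xs} {m} (x≢xs ∷ xs-unique) (there m∈xs) = cong₂ _+_
    (𝟙-cong {b = false} (mk⇔ (λ x≡ᵇm → All.lookup x≢xs m∈xs (≡ᵇ⇒≡ x m x≡ᵇm)) λ ()))
    (Σℕ-𝟙-≡ᵇ-∈ xs-unique m∈xs)

  Σℕ-𝟙-≡ᵇ-+𝟙 : {L : List ℕ} {m : ℕ} → Unique L → (b : Bool) → (¬ T b → m ∈ L) → (T b → m ∉ L) →
    Σℕ L (λ ℓ → 𝟙 (ℓ ≡ᵇ m)) + 𝟙 b ≡ 1
  Σℕ-𝟙-≡ᵇ-+𝟙 {L} _        true  _      b⇒m∉L = cong (λ z → z + 1) (Σℕ-𝟙-≡ᵇ-∉ L (b⇒m∉L tt))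
  Σℕ-𝟙-≡ᵇ-+𝟙     L-unique false ¬b⇒m∈L _     = cong (λ z → z + 0) (Σℕ-𝟙-≡ᵇ-∈ L-unique (¬b⇒m∈L λ ()))

  Σℤ-ℕ : (xs : List ℕ) (f : ℕ → ℕ) → Σℤ xs (λ x → + f x) ≡ + Σℕ xs f
  Σℤ-ℕ []       f = refl
  Σℤ-ℕ (x ∷ xs) f = cong (ℤ._+_ (+ f x)) (Σℤ-ℕ xs f)

  count : (A → Bool) → List A → ℕ
  count p xs = length (filter (λ x → T? (p x)) xs)

  count-∷ : (p : A → Bool) (x : A) (xs : List A) → count p (x ∷ xs) ≡ 𝟙 (p x) + count p xs
  count-∷ p x xs with p x
  ... | true  = refl
  ... | false = refl

  count-split : (L : List B) (p : A → Bool) (q : B → A → Bool) (r : A → Bool) →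
    (∀ x → Σℕ L (λ ℓ → 𝟙 (q ℓ x)) + 𝟙 (r x) ≡ 𝟙 (p x)) →
    ∀ xs → count p xs ≡ Σℕ L (λ ℓ → count (q ℓ) xs) + count r xs
  count-split L p q r split []       = sym (cong (λ z → z + 0) (Σℕ-zero L))
  count-split L p q r split (x ∷ xs) = begin
    count p (x ∷ xs)
      ≡⟨ count-∷ p x xs ⟩
    𝟙 (p x) + count p xs
      ≡⟨ cong₂ _+_ (sym (split x)) (count-split L p q r split xs) ⟩
    Σℕ L (λ ℓ → 𝟙 (q ℓ x)) + 𝟙 (r x) + (Σℕ L (λ ℓ → count (q ℓ) xs) + count r xs)
      ≡⟨ interchange +-commutativeSemigroup (Σℕ L (λ ℓ → 𝟙 (q ℓ x))) (𝟙 (r x)) _ (count r xs) ⟩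
    Σℕ L (λ ℓ → 𝟙 (q ℓ x)) + Σℕ L (λ ℓ → count (q ℓ) xs) + (𝟙 (r x) + count r xs)
      ≡⟨ cong₂ _+_ (sym (Σℕ-+ L _ _)) (sym (count-∷ r x xs)) ⟩
    Σℕ L (λ ℓ → 𝟙 (q ℓ x) + count (q ℓ) xs) + count r (x ∷ xs)
      ≡⟨ cong (λ z → z + count r (x ∷ xs)) (Σℕ-cong L (λ ℓ → sym (count-∷ (q ℓ) x xs))) ⟩
    Σℕ L (λ ℓ → count (q ℓ) (x ∷ xs)) + count r (x ∷ xs)
      ∎
    where open ≡-Reasoning

  count-injection : {xs : List A} {ys : List B} (p : A → Bool) (q : B → Bool) (g : B → A) →
    Injective _≡_ _≡_ g → Unique xs → Unique ys →
    (∀ {a} → a ∈ xs → T (p a) → ∃[ b ] b ∈ ys × a ≡ g b × T (q b)) →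
    (∀ {b} → b ∈ ys → T (q b) → g b ∈ xs × T (p (g b))) →
    count p xs ≡ count q ys
  count-injection {xs = xs} {ys} p q g g-injective xs-unique ys-unique covered preserved = begin
    length (filter p? xs)          ≡⟨ ↭-length (∼bag⇒↭ (unique∧set⇒bag filter-unique image-unique same-elements)) ⟩
    length (map g (filter q? ys))  ≡⟨ length-map g (filter q? ys) ⟩
    length (filter q? ys)          ∎
    where
    open ≡-Reasoning
    p? = λ a → T? (p a)
    q? = λ b → T? (q b)
    filter-unique = Unique.filter⁺ p? xs-unique
    image-unique = Unique.map⁺ g-injective (Unique.filter⁺ q? ys-unique)
    same-elements : filter p? xs ∼[ set ] map g (filter q? ys)
    same-elements = mk⇔
      (λ a∈ → let a∈xs , pa = ∈-filter⁻ p? a∈ in ∈-map∘filter⁺ g q? (covered a∈xs pa))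
      (λ a∈ → let b , b∈ys , a≡gb , qb = ∈-map∘filter⁻ g q? a∈
                  gb∈xs , pgb = preserved b∈ys qb
              in subst (_∈ filter p? xs) (sym a≡gb) (∈-filter⁺ p? gb∈xs pgb))

  m+n≡o⇒m≡o∸n : ∀ m n {o} → m + n ≡ o → m ≡ o ∸ n
  m+n≡o⇒m≡o∸n m n m+n≡o = trans (sym (m+n∸n≡m m n)) (cong (_∸ n) m+n≡o)

  allV-mono : {p q : ℕ → Bool} → (∀ x → T (p x) → T (q x)) → (v : Vec ℕ k) → T (allV p v) → T (allV q v)
  allV-mono p⇒q []      _   = tt
  allV-mono p⇒q (x ∷ v) pxv =
    let px , pv = to T-∧ pxv in from T-∧ (p⇒q x px , allV-mono p⇒q v pv)

  allV-occurrence : {p : ℕ → Bool} (i : ℕ) (v : Vec ℕ k) → T (anyV (λ x → x ≡ᵇ i) v) → T (allV p v) → T (p i)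
  allV-occurrence {p = p} i (x ∷ v) i∈xv pxv with to T-∨ i∈xv | to T-∧ pxv
  ... | inj₁ x≡ᵇi | px , _ = subst (T ∘ p) (≡ᵇ⇒≡ x i x≡ᵇi) px
  ... | inj₂ i∈v  | _ , pv = allV-occurrence i v i∈v pv

  allV-∷ʳ : (p : ℕ → Bool) (w : Vec ℕ k) (x : ℕ) → T (allV p (w ∷ʳ x)) ⇔ (T (allV p w) × T (p x))
  allV-∷ʳ p w x = subst (λ b → T b ⇔ (T (allV p w) × T (p x))) (sym (allV-∷ʳ-≡ w)) T-∧
    where
    allV-∷ʳ-≡ : (w : Vec ℕ k) → allV p (w ∷ʳ x) ≡ allV p w ∧ p x
    allV-∷ʳ-≡ []      = ∧-identityʳ (p x)
    allV-∷ʳ-≡ (y ∷ w) = trans (cong (p y ∧_) (allV-∷ʳ-≡ w)) (sym (∧-assoc (p y) (allV p w) (p x)))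

  anyV-∷ʳ-last : (w : Vec ℕ k) (x : ℕ) → T (anyV (λ y → y ≡ᵇ x) (w ∷ʳ x))
  anyV-∷ʳ-last []      x = from T-∨ (inj₁ (≡⇒≡ᵇ x x refl))
  anyV-∷ʳ-last (y ∷ w) x = from T-∨ (inj₂ (anyV-∷ʳ-last w x))

  vsum-∷ʳ : (w : Vec ℕ k) (x : ℕ) → vsum (w ∷ʳ x) ≡ vsum w + x
  vsum-∷ʳ []      x = +-identityʳ x
  vsum-∷ʳ (y ∷ w) x = trans (cong (_+_ y) (vsum-∷ʳ w x)) (sym (+-assoc y (vsum w) x))

  nonIncreasing-∷ʳ⁻ : (w : Vec ℕ k) (x : ℕ) → T (nonIncreasing (w ∷ʳ x)) →
    T (nonIncreasing w) × T (allV (x ≤ᵇ_) w)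
  nonIncreasing-∷ʳ⁻ []          x _  = tt , tt
  nonIncreasing-∷ʳ⁻ (y ∷ [])    x ni = tt , ni
  nonIncreasing-∷ʳ⁻ (y ∷ z ∷ w) x ni =
    let z≤y , ni′ = to T-∧ ni
        ni-zw , x≤zw = nonIncreasing-∷ʳ⁻ (z ∷ w) x ni′
        x≤z , _ = to T-∧ x≤zw
    in from T-∧ (z≤y , ni-zw) , from T-∧ (≤⇒≤ᵇ (≤-trans (≤ᵇ⇒≤ x z x≤z) (≤ᵇ⇒≤ z y z≤y)) , x≤zw)

  nonIncreasing-∷ʳ⁺ : (w : Vec ℕ k) (x : ℕ) → T (nonIncreasing w) → T (allV (x ≤ᵇ_) w) →
    T (nonIncreasing (w ∷ʳ x))
  nonIncreasing-∷ʳ⁺ []          x _  _   = tt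
  nonIncreasing-∷ʳ⁺ (y ∷ [])    x _  x≤y = x≤y
  nonIncreasing-∷ʳ⁺ (y ∷ z ∷ w) x ni x≤w =
    let z≤y , ni-zw = to T-∧ ni
        _ , x≤zw = to (T-∧ {x ≤ᵇ y}) x≤w
    in from T-∧ (z≤y , nonIncreasing-∷ʳ⁺ (z ∷ w) x ni-zw x≤zw)

  allV-map : (p : ℕ → Bool) (f : ℕ → ℕ) (v : Vec ℕ k) → allV p (Vec.map f v) ≡ allV (p ∘ f) v
  allV-map p f []      = refl
  allV-map p f (x ∷ v) = cong (p (f x) ∧_) (allV-map p f v)

  nonIncreasing-map : {f : ℕ → ℕ} → (∀ {x y} → x ≤ y → f x ≤ f y) → (v : Vec ℕ k) →
    T (nonIncreasing v) → T (nonIncreasing (Vec.map f v))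
  nonIncreasing-map f-mono []          _  = tt
  nonIncreasing-map f-mono (x ∷ [])    _  = tt
  nonIncreasing-map f-mono (x ∷ y ∷ v) ni =
    let y≤x , ni-yv = to T-∧ ni
    in from T-∧ (≤⇒≤ᵇ (f-mono (≤ᵇ⇒≤ y x y≤x)) , nonIncreasing-map f-mono (y ∷ v) ni-yv)

  vsum-map-+ : ∀ s (v : Vec ℕ k) → vsum (Vec.map (λ x → x + s) v) ≡ vsum v + s * k
  vsum-map-+ s []            = sym (*-zeroʳ s)
  vsum-map-+ s (_∷_ {k} x v) = begin
    x + s + vsum (Vec.map (λ x → x + s) v)  ≡⟨ cong (_+_ (x + s)) (vsum-map-+ s v) ⟩
    x + s + (vsum v + s * k)                ≡⟨ interchange +-commutativeSemigroup x s (vsum v) (s * k) ⟩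
    x + vsum v + (s + s * k)                ≡⟨ cong (_+_ (x + vsum v)) (sym (*-suc s k)) ⟩
    x + vsum v + s * suc k                  ∎
    where open ≡-Reasoning

  map-+-∸ : ∀ s (v : Vec ℕ k) → Vec.map (λ x → x ∸ s) (Vec.map (λ x → x + s) v) ≡ v
  map-+-∸ s []      = refl
  map-+-∸ s (x ∷ v) = cong₂ _∷_ (m+n∸n≡m x s) (map-+-∸ s v)

  map-∸-+ : ∀ s (v : Vec ℕ k) → T (allV (s ≤ᵇ_) v) → Vec.map (λ x → x + s) (Vec.map (λ x → x ∸ s) v) ≡ v
  map-∸-+ s []      _    = refl
  map-∸-+ s (x ∷ v) s≤xv =
    let s≤x , s≤v = to T-∧ s≤xv in cong₂ _∷_ (m∸n+n≡m (≤ᵇ⇒≤ s x s≤x)) (map-∸-+ s v s≤v)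

  map-+-injective : ∀ s → Injective _≡_ _≡_ (Vec.map {n = k} (λ x → x + s))
  map-+-injective s {v} {w} eq = begin
    v                                                ≡⟨ map-+-∸ s v ⟨
    Vec.map (λ x → x ∸ s) (Vec.map (λ x → x + s) v)  ≡⟨ cong (Vec.map (λ x → x ∸ s)) eq ⟩
    Vec.map (λ x → x ∸ s) (Vec.map (λ x → x + s) w)  ≡⟨ map-+-∸ s w ⟩
    w                                                ∎
    where open ≡-Reasoning

  -- The smallest part of a non-increasing vector

  smallestPartIs : ℕ → Vec ℕ k → Bool
  smallestPartIs ℓ v = allV (λ x → ℓ ≤ᵇ x) v ∧ anyV (λ x → x ≡ᵇ ℓ) v

  UpwardClosed : (ℕ → Bool) → Set
  UpwardClosed p = ∀ {x y} → x ≤ y → T (p x) → T (p y)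

  <ᵇ-upward : ∀ s → UpwardClosed (s <ᵇ_)
  <ᵇ-upward s {x} x≤y s<x = <⇒<ᵇ (<-≤-trans (<ᵇ⇒< s x s<x) x≤y)

  ≤ᵇ-upward : ∀ ℓ → UpwardClosed (ℓ ≤ᵇ_)
  ≤ᵇ-upward ℓ {x} x≤y ℓ≤x = ≤⇒≤ᵇ (≤-trans (≤ᵇ⇒≤ ℓ x ℓ≤x) x≤y)

  last-smallest : (w : Vec ℕ k) (m : ℕ) → T (nonIncreasing (w ∷ʳ m)) → T (allV (m ≤ᵇ_) (w ∷ʳ m))
  last-smallest w m ni = from (allV-∷ʳ _ w m) (proj₂ (nonIncreasing-∷ʳ⁻ w m ni) , ≤⇒≤ᵇ (≤-refl {m}))

  allV-upward-∷ʳ : {p : ℕ → Bool} → UpwardClosed p → (w : Vec ℕ k) (m : ℕ) → T (nonIncreasing (w ∷ʳ m)) →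
    T (allV p (w ∷ʳ m)) ⇔ T (p m)
  allV-upward-∷ʳ {p = p} upward w m ni = mk⇔
    (proj₂ ∘ to (allV-∷ʳ p w m))
    (λ pm → allV-mono (λ x m≤x → upward (≤ᵇ⇒≤ m x m≤x) pm) (w ∷ʳ m) (last-smallest w m ni))

  smallestPartIs-∷ʳ : (i : ℕ) (w : Vec ℕ k) (m : ℕ) → T (nonIncreasing (w ∷ʳ m)) →
    T (smallestPartIs i (w ∷ʳ m)) ⇔ T (i ≡ᵇ m)
  smallestPartIs-∷ʳ i w m ni = mk⇔ smallest⇒last last⇒smallest
    where
    smallest⇒last : T (smallestPartIs i (w ∷ʳ m)) → T (i ≡ᵇ m)
    smallest⇒last t =
      let i≤parts , i∈parts = to T-∧ t
          i≤m = ≤ᵇ⇒≤ i m (proj₂ (to (allV-∷ʳ _ w m) i≤parts))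
          m≤i = ≤ᵇ⇒≤ m i (allV-occurrence i (w ∷ʳ m) i∈parts (last-smallest w m ni))
      in ≡⇒≡ᵇ i m (≤-antisym i≤m m≤i)
    last⇒smallest : T (i ≡ᵇ m) → T (smallestPartIs i (w ∷ʳ m))
    last⇒smallest i≡ᵇm = subst (λ j → T (smallestPartIs j (w ∷ʳ m))) (sym (≡ᵇ⇒≡ i m i≡ᵇm))
      (from T-∧ (last-smallest w m ni , anyV-∷ʳ-last w m))

  smallest-part-classified : {L : List ℕ} → Unique L → {p : ℕ → Bool} → UpwardClosed p →
    (w : Vec ℕ k) (m : ℕ) → T (nonIncreasing (w ∷ʳ m)) → (¬ T (p m) → m ∈ L) → (T (p m) → m ∉ L) →
    Σℕ L (λ ℓ → 𝟙 (smallestPartIs ℓ (w ∷ʳ m))) + 𝟙 (allV p (w ∷ʳ m)) ≡ 1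
  smallest-part-classified {L = L} L-unique {p} upward w m ni below above = begin
    Σℕ L (λ ℓ → 𝟙 (smallestPartIs ℓ (w ∷ʳ m))) + 𝟙 (allV p (w ∷ʳ m))
      ≡⟨ cong₂ _+_ (Σℕ-cong L (λ ℓ → 𝟙-cong (smallestPartIs-∷ʳ ℓ w m ni)))
                   (𝟙-cong (allV-upward-∷ʳ upward w m ni)) ⟩
    Σℕ L (λ ℓ → 𝟙 (ℓ ≡ᵇ m)) + 𝟙 (p m)
      ≡⟨ Σℕ-𝟙-≡ᵇ-+𝟙 L-unique (p m) below above ⟩
    1 ∎
    where open ≡-Reasoning

  -- Enumerating partitions

  oneTo : ℕ → List ℕ
  oneTo n = map suc (upTo n)

  ∈-oneTo⁺ : ∀ {m n} → 1 ≤ m → m ≤ n → m ∈ oneTo n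
  ∈-oneTo⁺ {suc j} _ j<n = ∈-map⁺ suc (∈-upTo⁺ j<n)

  ∈-oneTo⁻ : ∀ {m n} → m ∈ oneTo n → 1 ≤ m × m ≤ n
  ∈-oneTo⁻ m∈ with ∈-map⁻ suc m∈
  ... | j , j∈ , refl = s≤s z≤n , ∈-upTo⁻ j∈

  oneTo-unique : ∀ n → Unique (oneTo n)
  oneTo-unique n = Unique.map⁺ suc-injective (Unique.upTo⁺ n)

  concatMap≡cartesianProductWith : (f : A → B → D) (xs : List A) (ys : List B) →
    concatMap (λ x → map (f x) ys) xs ≡ cartesianProductWith f xs ys
  concatMap≡cartesianProductWith f []       ys = refl
  concatMap≡cartesianProductWith f (x ∷ xs) ys =
    cong (map (f x) ys ++_) (concatMap≡cartesianProductWith f xs ys)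

  candidates-suc : ∀ k n → candidates (suc k) n ≡ cartesianProductWith _∷_ (oneTo n) (candidates k n)
  candidates-suc k n = concatMap≡cartesianProductWith _∷_ (oneTo n) (candidates k n)

  candidates-unique : ∀ k n → Unique (candidates k n)
  candidates-unique zero    n = [] ∷ []
  candidates-unique (suc k) n = subst Unique (sym (candidates-suc k n))
    (Unique.cartesianProductWith⁺ _∷_ ∷-injective (oneTo-unique n) (candidates-unique k n))

  ∈-candidates : ∀ {n} (v : Vec ℕ k) → T (allV (1 ≤ᵇ_) v) → T (allV (λ x → x ≤ᵇ n) v) → v ∈ candidates k n
  ∈-candidates             []      _   _       = here refl
  ∈-candidates {suc k} {n} (x ∷ v) pos bounded =
    let 1≤x , pos-v     = to T-∧ pos
        x≤n , bounded-v = to T-∧ bounded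
    in subst (x ∷ v ∈_) (sym (candidates-suc k n))
         (∈-cartesianProductWith⁺ _∷_ (∈-oneTo⁺ (≤ᵇ⇒≤ 1 x 1≤x) (≤ᵇ⇒≤ x n x≤n)) (∈-candidates v pos-v bounded-v))

  isPartition⁻ : ∀ n (v : Vec ℕ k) → T (isPartition n v) →
    T (allV (1 ≤ᵇ_) v) × T (nonIncreasing v) × vsum v ≡ n
  isPartition⁻ n v t = let pos , rest = to T-∧ t; ni , sum = to T-∧ rest in pos , ni , ≡ᵇ⇒≡ (vsum v) n sum

  isPartition⁺ : ∀ n (v : Vec ℕ k) → T (allV (1 ≤ᵇ_) v) → T (nonIncreasing v) → vsum v ≡ n →
    T (isPartition n v)
  isPartition⁺ n v pos ni sum = from T-∧ (pos , from T-∧ (ni , ≡⇒≡ᵇ (vsum v) n sum))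

  isPartition-∷ʳ : ∀ {n x} (w : Vec ℕ k) → 1 ≤ x → x ≤ n →
    T (isPartition n (w ∷ʳ x)) ⇔ (T (isPartition (n ∸ x) w) × T (allV (x ≤ᵇ_) w))
  isPartition-∷ʳ {n = n} {x} w 1≤x x≤n = mk⇔ split join
    where
    split : T (isPartition n (w ∷ʳ x)) → T (isPartition (n ∸ x) w) × T (allV (x ≤ᵇ_) w)
    split isP =
      let pos , ni , sum = isPartition⁻ n (w ∷ʳ x) isP
          pos-w , _ = to (allV-∷ʳ _ w x) pos
          ni-w , x≤w = nonIncreasing-∷ʳ⁻ w x ni
          sum-w = m+n≡o⇒m≡o∸n (vsum w) x (trans (sym (vsum-∷ʳ w x)) sum)
      in isPartition⁺ (n ∸ x) w pos-w ni-w sum-w , x≤w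
    join : T (isPartition (n ∸ x) w) × T (allV (x ≤ᵇ_) w) → T (isPartition n (w ∷ʳ x))
    join (isP-w , x≤w) =
      let pos-w , ni-w , sum-w = isPartition⁻ (n ∸ x) w isP-w
          pos = from (allV-∷ʳ _ w x) (pos-w , ≤⇒≤ᵇ 1≤x)
          sum = trans (vsum-∷ʳ w x) (trans (cong (_+ x) sum-w) (m∸n+n≡m x≤n))
      in isPartition⁺ n (w ∷ʳ x) pos (nonIncreasing-∷ʳ⁺ w x ni-w x≤w) sum

  parts-≤-vsum : (v : Vec ℕ k) → T (allV (λ x → x ≤ᵇ vsum v) v)
  parts-≤-vsum []      = tt
  parts-≤-vsum (x ∷ v) = from T-∧ (≤⇒≤ᵇ (m≤m+n x (vsum v)) , allV-mono weaken v (parts-≤-vsum v))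
    where
    weaken : ∀ y → T (y ≤ᵇ vsum v) → T (y ≤ᵇ x + vsum v)
    weaken y y≤ = ≤⇒≤ᵇ (≤-trans (≤ᵇ⇒≤ y (vsum v) y≤) (m≤n+m (vsum v) x))

  partition-∈-candidates : ∀ n (v : Vec ℕ k) → T (isPartition n v) → v ∈ candidates k n
  partition-∈-candidates n v t =
    let pos , _ , sum = isPartition⁻ n v t
    in ∈-candidates v pos (subst (λ m → T (allV (λ x → x ≤ᵇ m) v)) sum (parts-≤-vsum v))

  countParts-split : ∀ {n} (L : List ℕ) (P : Vec ℕ k → Bool) (q : ℕ → Vec ℕ k → Bool) (r : Vec ℕ k → Bool) →
    (∀ v → T (isPartition n v) → T (P v) → Σℕ L (λ ℓ → 𝟙 (q ℓ v)) + 𝟙 (r v) ≡ 1) →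
    countParts k P (+ n) ≡
      Σℕ L (λ ℓ → countParts k (λ v → P v ∧ q ℓ v) (+ n)) + countParts k (λ v → P v ∧ r v) (+ n)
  countParts-split {k} {n} L P q r classified = count-split L _ _ _ split (candidates k n)
    where
    split : ∀ v → Σℕ L (λ ℓ → 𝟙 (isPartition n v ∧ (P v ∧ q ℓ v))) + 𝟙 (isPartition n v ∧ (P v ∧ r v))
                  ≡ 𝟙 (isPartition n v ∧ P v)
    split v with isPartition n v in isP | P v in Pv
    ... | false | _     = cong (λ z → z + 0) (Σℕ-zero L)
    ... | true  | false = cong (λ z → z + 0) (Σℕ-zero L)
    ... | true  | true  = classified v (from T-≡ isP) (from T-≡ Pv)

  countParts-injection : ∀ {k′ n m} (P : Vec ℕ k → Bool) (Q : Vec ℕ k′ → Bool) (g : Vec ℕ k′ → Vec ℕ k) →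
    Injective _≡_ _≡_ g →
    (∀ v → T (isPartition n v ∧ P v) → ∃[ w ] v ≡ g w) →
    (∀ w → T (isPartition n (g w) ∧ P (g w)) ⇔ T (isPartition m w ∧ Q w)) →
    countParts k P (+ n) ≡ countParts k′ Q (+ m)
  countParts-injection {k} {k′} {n} {m} P Q g g-injective covers preserves =
    count-injection _ _ g g-injective (candidates-unique k n) (candidates-unique k′ m) covered preserved
    where
    covered : ∀ {v} → v ∈ candidates k n → T (isPartition n v ∧ P v) →
      ∃[ w ] w ∈ candidates k′ m × v ≡ g w × T (isPartition m w ∧ Q w)
    covered {v} _ t with covers v t
    ... | w , refl = let t′ = to (preserves w) t
                     in w , partition-∈-candidates m w (proj₁ (to T-∧ t′)) , refl , t′
    preserved : ∀ {w} → w ∈ candidates k′ m → T (isPartition m w ∧ Q w) →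
      g w ∈ candidates k n × T (isPartition n (g w) ∧ P (g w))
    preserved {w} _ t = let t′ = from (preserves w) t
                        in partition-∈-candidates n (g w) (proj₁ (to T-∧ t′)) , t′

  countParts-none : ∀ {n} (P : Vec ℕ k → Bool) → (∀ v → T (isPartition n v ∧ P v) → ⊥) →
    countParts k P (+ n) ≡ 0
  countParts-none {k} {n} P none =
    cong length (filter-none (λ v → T? (isPartition n v ∧ P v)) (All.universal none (candidates k n)))

  -- Residues modulo s and the index sets N(s), N′(ℓ)

  allowed : ℕ → ℕ → Bool
  allowed s x = not (forbiddenResidue s x)

  forbiddenResidue-+ : ∀ s x → forbiddenResidue s (x + s) ≡ forbiddenResidue s x
  forbiddenResidue-+ zero    x = cong (forbiddenResidue 0) (+-identityʳ x)
  forbiddenResidue-+ (suc s) x rewrite [m+n]%n≡m%n x (suc s) ⦃ _ ⦄ = refl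

  sCongruent-map-+ : ∀ s (v : Vec ℕ k) → sCongruent s (Vec.map (λ x → x + s) v) ≡ sCongruent s v
  sCongruent-map-+ s []      = refl
  sCongruent-map-+ s (x ∷ v) = cong₂ _∧_ (cong not (forbiddenResidue-+ s x)) (sCongruent-map-+ s v)

  forbiddenResidue-below : ∀ {s m} → m < s → forbiddenResidue s m ≡ isEven m ∧ (2 ≤ᵇ m) ∧ (m ≤ᵇ s ∸ 2)
  forbiddenResidue-below {suc s} m<s rewrite m<n⇒m%n≡m m<s = refl

  even-below-even-forbidden : ∀ {s m} → 2 ∣ s → 2 ∣ m → 1 ≤ m → m < s → T (forbiddenResidue s m)
  even-below-even-forbidden (divides b refl) (divides (suc a) refl) _ m<s rewrite forbiddenResidue-below m<s =
    from T-∧ (≡⇒≡ᵇ _ 0 (m*n%n≡0 (suc a) 2) , from T-∧ (≤⇒≤ᵇ (m≤m+n 2 (a * 2)) , ≤⇒≤ᵇ m≤s∸2))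
    where
    m+2≤s : suc a * 2 + 2 ≤ b * 2
    m+2≤s = subst (_≤ b * 2) (+-comm 2 (suc a * 2)) (*-monoˡ-≤ 2 (*-cancelʳ-< 2 (suc a) b m<s))
    m≤s∸2 : suc a * 2 ≤ b * 2 ∸ 2
    m≤s∸2 = m+n≤o⇒m≤o∸n (suc a * 2) m+2≤s

  allowed-below-even-odd : ∀ {s m} → 2 ∣ s → 1 ≤ m → m < s → T (allowed s m) → T (isOdd m)
  allowed-below-even-odd {s} {m} 2∣s 1≤m m<s ok with isEven m in even
  ... | false = tt
  ... | true  = ⊥-elim (subst T (to T-not-≡ ok) (even-below-even-forbidden 2∣s 2∣m 1≤m m<s))
    where
    2∣m : 2 ∣ m
    2∣m = m%n≡0⇒n∣m m 2 (≡ᵇ⇒≡ (m % 2) 0 (from T-≡ even))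

  odd-below-allowed : ∀ {s m} → T (isOdd m) → m < s → T (allowed s m)
  odd-below-allowed odd m<s rewrite forbiddenResidue-below m<s | to T-not-≡ odd = tt

  allowed-self : ∀ {s} → 1 ≤ s → T (allowed s s)
  allowed-self {suc s} _ rewrite n%n≡0 (suc s) ⦃ _ ⦄ = tt

  N-unique : ∀ s → Unique (N s)
  N-unique s = Unique.filter⁺ _ (oneTo-unique s)

  N′-unique : ∀ ℓ → Unique (N′ ℓ)
  N′-unique ℓ = Unique.filter⁺ _ (oneTo-unique (ℓ ∸ 1))

  ∈-N : ∀ {s m} → 2 ∣ s → 1 ≤ m → m ≤ s → T (allowed s m) → m ∈ N s
  ∈-N {s} {m} 2∣s 1≤m m≤s ok = ∈-filter⁺ _ (∈-oneTo⁺ 1≤m m≤s) odd-or-s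
    where
    odd-or-s : T ((isOdd m ∧ (m <ᵇ s)) ∨ (m ≡ᵇ s))
    odd-or-s with m ≟ s
    ... | yes m≡s = from T-∨ (inj₂ (≡⇒≡ᵇ m s m≡s))
    ... | no  m≢s = let m<s = ≤∧≢⇒< m≤s m≢s
                    in from T-∨ (inj₁ (from T-∧ (allowed-below-even-odd 2∣s 1≤m m<s ok , <⇒<ᵇ m<s)))

  ∈-N⁻ : ∀ {s ℓ} → ℓ ∈ N s → 1 ≤ ℓ × ℓ ≤ s × T (allowed s ℓ)
  ∈-N⁻ {s} {ℓ} ℓ∈N =
    let ℓ∈oneTo , odd-or-s = ∈-filter⁻ _ {xs = oneTo s} ℓ∈N
        1≤ℓ , ℓ≤s = ∈-oneTo⁻ ℓ∈oneTo
    in 1≤ℓ , ℓ≤s , allowed-ℓ 1≤ℓ (to T-∨ odd-or-s)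
    where
    allowed-ℓ : 1 ≤ ℓ → T (isOdd ℓ ∧ (ℓ <ᵇ s)) ⊎ T (ℓ ≡ᵇ s) → T (allowed s ℓ)
    allowed-ℓ _   (inj₁ odd∧ℓ<s) = let odd , ℓ<s = to T-∧ odd∧ℓ<s in odd-below-allowed odd (<ᵇ⇒< ℓ s ℓ<s)
    allowed-ℓ 1≤ℓ (inj₂ ℓ≡ᵇs)    = subst (λ x → T (allowed x ℓ)) (≡ᵇ⇒≡ ℓ s ℓ≡ᵇs) (allowed-self 1≤ℓ)

  ∈-N′ : ∀ {ℓ m} → T (isOdd m) → 1 ≤ m → m < ℓ → m ∈ N′ ℓ
  ∈-N′ {suc l} odd 1≤m m<ℓ = ∈-filter⁺ (λ i → T? (isOdd i)) (∈-oneTo⁺ 1≤m (s≤s⁻¹ m<ℓ)) odd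

  ∈-N′⁻ : ∀ {ℓ m} → m ∈ N′ ℓ → m < ℓ
  ∈-N′⁻ {suc l} m∈N′ =
    s≤s (proj₂ (∈-oneTo⁻ (proj₁ (∈-filter⁻ (λ i → T? (isOdd i)) {xs = oneTo l} m∈N′))))

  -- Splitting and shifting s-congruent partitions

  last-part-allowed : ∀ {s n} (w : Vec ℕ k) (m : ℕ) → T (isPartition n (w ∷ʳ m)) → T (sCongruent s (w ∷ʳ m)) →
    T (nonIncreasing (w ∷ʳ m)) × 1 ≤ m × T (allowed s m)
  last-part-allowed {n = n} w m isP sC =
    let pos , ni , _ = isPartition⁻ n (w ∷ʳ m) isP
    in ni , ≤ᵇ⇒≤ 1 m (proj₂ (to (allV-∷ʳ _ w m) pos)) , proj₂ (to (allV-∷ʳ _ w m) sC)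

  smallest-in-N-or-above : ∀ {s n} → 2 ∣ s → (v : Vec ℕ (suc k)) → T (isPartition n v) → T (sCongruent s v) →
    Σℕ (N s) (λ ℓ → 𝟙 (smallestPartIs ℓ v)) + 𝟙 (allV (s <ᵇ_) v) ≡ 1
  smallest-in-N-or-above {s = s} 2∣s v isP sC with initLast v
  ... | w , m , refl with last-part-allowed {s = s} w m isP sC
  ...   | ni , 1≤m , ok = smallest-part-classified (N-unique s) (<ᵇ-upward s) w m ni
          (λ s≮m → ∈-N 2∣s 1≤m (≮⇒≥ (s≮m ∘ <⇒<ᵇ)) ok)
          (λ s<m m∈N → <⇒≱ (<ᵇ⇒< s m s<m) (proj₁ (proj₂ (∈-N⁻ m∈N))))

  smallest-in-N′-or-atLeast : ∀ {s ℓ n} → 2 ∣ s → ℓ ≤ s → (v : Vec ℕ k) → T (isPartition n v) →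
    T (sCongruent s v) → Σℕ (N′ ℓ) (λ i → 𝟙 (smallestPartIs i v)) + 𝟙 (allV (ℓ ≤ᵇ_) v) ≡ 1
  smallest-in-N′-or-atLeast {zero}  {ℓ = ℓ} _ _ [] _ _ = cong (λ z → z + 1) (Σℕ-zero (N′ ℓ))
  smallest-in-N′-or-atLeast {suc k} {s} {ℓ} 2∣s ℓ≤s v isP sC with initLast v
  ... | w , m , refl with last-part-allowed {s = s} w m isP sC
  ...   | ni , 1≤m , ok = smallest-part-classified (N′-unique ℓ) (≤ᵇ-upward ℓ) w m ni
          (λ ℓ≰m → let m<ℓ = ≰⇒> (ℓ≰m ∘ ≤⇒≤ᵇ)
                   in ∈-N′ (allowed-below-even-odd 2∣s 1≤m (<-≤-trans m<ℓ ℓ≤s) ok) 1≤m m<ℓ)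
          (λ ℓ≤m m∈N′ → <⇒≱ (∈-N′⁻ m∈N′) (≤ᵇ⇒≤ ℓ m ℓ≤m))

  C≥ : (s ℓ : ℕ) → ℤ → ℕ → ℕ
  C≥ s ℓ n k = countParts k (λ v → sCongruent s v ∧ allV (λ x → ℓ ≤ᵇ x) v) n

  C-by-smallest-part : ∀ s n k → 2 ∣ s →
    C s (+ n) (suc k) ≡ Σℕ (N s) (λ ℓ → Cℓ s ℓ (+ n) (suc k)) + Cbig s (+ n) (suc k)
  C-by-smallest-part s n k 2∣s =
    countParts-split {n = n} (N s) (sCongruent s) smallestPartIs (allV (s <ᵇ_)) (smallest-in-N-or-above 2∣s)

  C-by-smallest-part-below : ∀ s ℓ n k → 2 ∣ s → ℓ ≤ s →
    C s (+ n) k ≡ Σℕ (N′ ℓ) (λ i → Cℓ s i (+ n) k) + C≥ s ℓ (+ n) k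
  C-by-smallest-part-below s ℓ n k 2∣s ℓ≤s = countParts-split {k} {n} (N′ ℓ) (sCongruent s) smallestPartIs
    (allV (ℓ ≤ᵇ_)) (smallest-in-N′-or-atLeast 2∣s ℓ≤s)

  Cℓ≡C≥ : ∀ s ℓ n k → 1 ≤ ℓ → ℓ ≤ n → T (allowed s ℓ) → Cℓ s ℓ (+ n) (suc k) ≡ C≥ s ℓ (+ (n ∸ ℓ)) k
  Cℓ≡C≥ s ℓ n k 1≤ℓ ℓ≤n ok = countParts-injection _ _ (_∷ʳ ℓ) (∷ʳ-injectiveˡ _ _) ends-with-ℓ dropping-ℓ
    where
    ends-with-ℓ : ∀ v → T (isPartition n v ∧ (sCongruent s v ∧ smallestPartIs ℓ v)) → ∃[ w ] v ≡ w ∷ʳ ℓ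
    ends-with-ℓ v t with initLast v
    ... | w , m , refl =
      let isP , sC∧smallest = to (T-∧ {isPartition n (w ∷ʳ m)}) t
          sC , smallest = to (T-∧ {sCongruent s (w ∷ʳ m)}) sC∧smallest
          ni , _ = last-part-allowed {s = s} w m isP sC
      in w , cong (w ∷ʳ_) (sym (≡ᵇ⇒≡ ℓ m (to (smallestPartIs-∷ʳ ℓ w m ni) smallest)))
    dropping-ℓ : ∀ w → T (isPartition n (w ∷ʳ ℓ) ∧ (sCongruent s (w ∷ʳ ℓ) ∧ smallestPartIs ℓ (w ∷ʳ ℓ)))
                     ⇔ T (isPartition (n ∸ ℓ) w ∧ (sCongruent s w ∧ allV (ℓ ≤ᵇ_) w))
    dropping-ℓ w = mk⇔
      (λ t → let isP , sC∧smallest = to (T-∧ {isPartition n (w ∷ʳ ℓ)}) t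
                 isP-w , ℓ≤w = to (isPartition-∷ʳ w 1≤ℓ ℓ≤n) isP
                 sC-w , _ = to (allV-∷ʳ _ w ℓ) (proj₁ (to (T-∧ {sCongruent s (w ∷ʳ ℓ)}) sC∧smallest))
             in from T-∧ (isP-w , from T-∧ (sC-w , ℓ≤w)))
      (λ t → let isP-w , sC-w∧ℓ≤w = to (T-∧ {isPartition (n ∸ ℓ) w}) t
                 sC-w , ℓ≤w = to (T-∧ {sCongruent s w}) sC-w∧ℓ≤w
                 isP = from (isPartition-∷ʳ w 1≤ℓ ℓ≤n) (isP-w , ℓ≤w)
                 _ , ni , _ = isPartition⁻ n (w ∷ʳ ℓ) isP
                 smallest = from (smallestPartIs-∷ʳ ℓ w ℓ ni) (≡⇒≡ᵇ ℓ ℓ refl)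
             in from T-∧ (isP , from T-∧ (from (allV-∷ʳ _ w ℓ) (sC-w , ok) , smallest)))

  Cℓ-empty : ∀ s ℓ n k → n < ℓ → Cℓ s ℓ (+ n) k ≡ 0
  Cℓ-empty s ℓ n k n<ℓ = countParts-none _ too-large
    where
    too-large : ∀ (v : Vec ℕ k) → T (isPartition n v ∧ (sCongruent s v ∧ smallestPartIs ℓ v)) → ⊥
    too-large v t =
      let isP , sC∧smallest = to (T-∧ {isPartition n v}) t
          _ , _ , sum = isPartition⁻ n v isP
          _ , ℓ∈v = to (T-∧ {allV (ℓ ≤ᵇ_) v}) (proj₂ (to (T-∧ {sCongruent s v}) sC∧smallest))
          ℓ≤sum = ≤ᵇ⇒≤ ℓ (vsum v) (allV-occurrence ℓ v ℓ∈v (parts-≤-vsum v))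
      in <⇒≱ n<ℓ (subst (ℓ ≤_) sum ℓ≤sum)

  above-s-shifted : ∀ s (v : Vec ℕ k) → T (allV (s <ᵇ_) v) → ∃[ w ] v ≡ Vec.map (λ x → x + s) w
  above-s-shifted s v s<v = Vec.map (λ x → x ∸ s) v , sym (map-∸-+ s v (allV-mono s<x⇒s≤x v s<v))
    where
    s<x⇒s≤x : ∀ x → T (s <ᵇ x) → T (s ≤ᵇ x)
    s<x⇒s≤x x s<x = ≤⇒≤ᵇ (<⇒≤ (<ᵇ⇒< s x s<x))

  Cbig≡C : ∀ s n k → s * k ≤ n → Cbig s (+ n) k ≡ C s (+ (n ∸ s * k)) k
  Cbig≡C s n k sk≤n = countParts-injection _ _ shift (map-+-injective s) covers unshifting
    where
    shift : Vec ℕ k → Vec ℕ k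
    shift = Vec.map (λ x → x + s)
    covers : ∀ v → T (isPartition n v ∧ (sCongruent s v ∧ allV (s <ᵇ_) v)) → ∃[ w ] v ≡ shift w
    covers v t = above-s-shifted s v (proj₂ (to (T-∧ {sCongruent s v}) (proj₂ (to (T-∧ {isPartition n v}) t))))
    positive⇔above-s : ∀ w → T (allV (1 ≤ᵇ_) w) ⇔ T (allV (s <ᵇ_) (shift w))
    positive⇔above-s w = mk⇔
      (λ pos → subst T (sym (allV-map _ _ w))
                 (allV-mono (λ x 1≤x → <⇒<ᵇ (+-monoˡ-≤ s (≤ᵇ⇒≤ 1 x 1≤x))) w pos))
      (λ s< → allV-mono (λ x s<x+s → ≤⇒≤ᵇ (+-cancelʳ-≤ s 1 x (<ᵇ⇒< s (x + s) s<x+s))) w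
                        (subst T (allV-map _ _ w) s<))
    unshifting : ∀ w → T (isPartition n (shift w) ∧ (sCongruent s (shift w) ∧ allV (s <ᵇ_) (shift w)))
                     ⇔ T (isPartition (n ∸ s * k) w ∧ sCongruent s w)
    unshifting w = mk⇔
      (λ t → let isP , sC∧above = to (T-∧ {isPartition n (shift w)}) t
                 sC , above = to (T-∧ {sCongruent s (shift w)}) sC∧above
                 _ , ni , sum = isPartition⁻ n (shift w) isP
                 ni-w = subst (T ∘ nonIncreasing) (map-+-∸ s w) (nonIncreasing-map (∸-monoˡ-≤ s) (shift w) ni)
                 sum-w = m+n≡o⇒m≡o∸n (vsum w) (s * k) (trans (sym (vsum-map-+ s w)) sum)
             in from T-∧ ( isPartition⁺ (n ∸ s * k) w (from (positive⇔above-s w) above) ni-w sum-w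
                         , subst T (sCongruent-map-+ s w) sC))
      (λ t → let isP-w , sC-w = to (T-∧ {isPartition (n ∸ s * k) w}) t
                 pos-w , ni-w , sum-w = isPartition⁻ (n ∸ s * k) w isP-w
                 above = to (positive⇔above-s w) pos-w
                 pos = allV-mono (λ x s<x → ≤⇒≤ᵇ (≤-trans (s≤s z≤n) (<ᵇ⇒< s x s<x))) (shift w) above
                 sum = trans (vsum-map-+ s w) (trans (cong (_+ s * k) sum-w) (m∸n+n≡m sk≤n))
             in from T-∧ ( isPartition⁺ n (shift w) pos (nonIncreasing-map (+-monoˡ-≤ s) w ni-w) sum
                         , from T-∧ (subst T (sym (sCongruent-map-+ s w)) sC-w , above)))

  Cbig-empty : ∀ s n k → n < s * k → Cbig s (+ n) k ≡ 0
  Cbig-empty s n k n<sk = countParts-none _ too-small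
    where
    too-small : ∀ (v : Vec ℕ k) → T (isPartition n v ∧ (sCongruent s v ∧ allV (s <ᵇ_) v)) → ⊥
    too-small v t with above-s-shifted s v (proj₂ (to (T-∧ {sCongruent s v}) (proj₂ (to (T-∧ {isPartition n v}) t))))
    ... | w , refl =
      let shifted = Vec.map (λ x → x + s) w
          _ , _ , sum = isPartition⁻ n shifted (proj₁ (to (T-∧ {isPartition n shifted}) t))
      in <⇒≱ n<sk (subst (s * k ≤_) (trans (sym (vsum-map-+ s w)) sum) (m≤n+m (s * k) (vsum w)))

  +m-+n≡+[m∸n] : ∀ {m n} → n ≤ m → + m - + n ≡ + (m ∸ n)
  +m-+n≡+[m∸n] {m} {n} n≤m = trans ([+m]-[+n]≡m⊖n m n) (⊖-≥ n≤m)

  +m-+n-negative : ∀ {m n} → m < n → ∃[ j ] + m - + n ≡ -[1+ j ]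
  +m-+n-negative {m} {n} m<n rewrite [+m]-[+n]≡m⊖n m n | ⊖-< m<n with n ∸ m | m<n⇒0<n∸m m<n
  ... | suc j | _ = j , refl

  m+n≡o⇒+n≡+o-+m : ∀ m n {o} → m + n ≡ o → + n ≡ + o - + m
  m+n≡o⇒+n≡+o-+m m n refl = sym (trans (+m-+n≡+[m∸n] (m≤m+n m n)) (cong +_ (m+n∸m≡n m n)))

  -- For n < ℓ both sides vanish, countParts being 0 at negative arguments.
  Cℓ-recurrence : ∀ s ℓ n k → 2 ∣ s → ℓ ∈ N s →
    Σℕ (N′ ℓ) (λ i → Cℓ s i (+ n - + ℓ) k) + Cℓ s ℓ (+ n) (suc k) ≡ C s (+ n - + ℓ) k
  Cℓ-recurrence s ℓ n k 2∣s ℓ∈N with ∈-N⁻ ℓ∈N | ℓ ≤? n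
  ... | 1≤ℓ , ℓ≤s , ok | yes ℓ≤n rewrite +m-+n≡+[m∸n] ℓ≤n =
    trans (cong (_+_ _) (Cℓ≡C≥ s ℓ n k 1≤ℓ ℓ≤n ok)) (sym (C-by-smallest-part-below s ℓ (n ∸ ℓ) k 2∣s ℓ≤s))
  ... | _ | no ℓ≰n with +m-+n-negative (≰⇒> ℓ≰n)
  ...   | _ , n-ℓ<0 rewrite n-ℓ<0 = cong₂ _+_ (Σℕ-zero (N′ ℓ)) (Cℓ-empty s ℓ n (suc k) (≰⇒> ℓ≰n))

  Cbig-recurrence : ∀ s n k → Cbig s (+ n) k ≡ C s (+ n - + (s * k)) k
  Cbig-recurrence s n k with s * k ≤? n
  ... | yes sk≤n rewrite +m-+n≡+[m∸n] sk≤n = Cbig≡C s n k sk≤n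
  ... | no  sk≰n with +m-+n-negative (≰⇒> sk≰n)
  ...   | _ , n-sk<0 rewrite n-sk<0 = Cbig-empty s n k (≰⇒> sk≰n)

open Lemmas
open import Data.Integer using (ℤ; +_; _+_; _-_)
open import Data.List.Membership.Propositional using (_∈_)
open import Data.Nat using (ℕ; zero; suc; _≤_; _*_)
open import Data.Nat.Divisibility using (_∣_)
open import Data.Product using (_×_; _,_)
open import Relation.Binary.PropositionalEquality using (_≡_; cong; sym; trans)

theorem7 : (s : ℕ) → 2 ∣ s → 4 ≤ s → (n k : ℕ) → 1 ≤ n → 1 ≤ k →
    ((+ C s (+ n) k) ≡ Σℤ (N s) (λ ℓ → + Cℓ s ℓ (+ n) k) + (+ Cbig s (+ n) k))
    × ((ℓ : ℕ) → ℓ ∈ N s →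
        (+ Cℓ s ℓ (+ n) k) ≡ (+ C s (+ n - + ℓ) (k Data.Nat.∸ 1))
                              - Σℤ (N′ ℓ) (λ i → + Cℓ s i (+ n - + ℓ) (k Data.Nat.∸ 1)))
    × ((+ Cbig s (+ n) k) ≡ + C s (+ n - + (s * k)) k)
theorem7 s _   _ n zero    _ ()
theorem7 s 2∣s _ n (suc k) _ _ = by-smallest-part , removing-smallest-part , cong +_ (Cbig-recurrence s n (suc k))
  where
  by-smallest-part : + C s (+ n) (suc k) ≡ Σℤ (N s) (λ ℓ → + Cℓ s ℓ (+ n) (suc k)) + + Cbig s (+ n) (suc k)
  by-smallest-part = trans (cong +_ (C-by-smallest-part s n k 2∣s))
    (cong (_+ + Cbig s (+ n) (suc k)) (sym (Σℤ-ℕ (N s) (λ ℓ → Cℓ s ℓ (+ n) (suc k)))))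
  removing-smallest-part : (ℓ : ℕ) → ℓ ∈ N s →
    + Cℓ s ℓ (+ n) (suc k) ≡ + C s (+ n - + ℓ) k - Σℤ (N′ ℓ) (λ i → + Cℓ s i (+ n - + ℓ) k)
  removing-smallest-part ℓ ℓ∈N = trans (m+n≡o⇒+n≡+o-+m _ _ (Cℓ-recurrence s ℓ n k 2∣s ℓ∈N))
    (cong (_-_ (+ C s (+ n - + ℓ) k)) (sym (Σℤ-ℕ (N′ ℓ) (λ i → Cℓ s i (+ n - + ℓ) k))))
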